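{- Every minimally non-$2$-list-colourable hypergraph is a core.
   Context: A hypergraph $H$ is $2$-list-colourable if for every assignment of a list of $2$ colours to each vertex, there is a choice of a colour from each vertex's list such that no edge of $H$ is monochromatic. $H$ is minimally non-$2$-list-colourable if it is not $2$-list-colourable but every proper subhypergraph of it is. A connected hypergraph $H$ is a core if for every edge $e \in H$ and every vertex $v \in e$ there is an edge $e' \in H$ with $e \cap e' = \{v\}$. -}

module Defs where

open import Data.Nat using (ℕ)
open import Data.Fin using (Fin)
open import Data.Fin.Subset using (Subset) renaming (_∈_ to _∈ₛ_)
open import Data.List using (List)
open import Data.List.Membership.Propositional using () renaming (_∈_ to _∈ₗ_; _∉_ to _∉ₗ_)
open import Data.List.Relation.Unary.All using (All)
open import Data.Product using (Σ; _×_; ∃; ∃-syntax; proj₁; proj₂)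
open import Data.Sum using (_⊎_)
open import Relation.Nullary using (¬_)
open import Relation.Binary.PropositionalEquality using (_≡_; _≢_)

-- The vertex set of H is the union of its edges
-- (a list is read as a set: duplicates and order are irrelevant everywhere below).
Hypergraph : ℕ → Set
Hypergraph n = List (Subset n)

IsVertex : ∀ {n} → Hypergraph n → Fin n → Set
IsVertex H v = ∃[ e ] (e ∈ₗ H × v ∈ₛ e)

ListAssignment : ℕ → Set
ListAssignment n = Fin n → ℕ × ℕ

IsTwoList : ∀ {n} → ListAssignment n → Set
IsTwoList L = ∀ v → proj₁ (L v) ≢ proj₂ (L v)

ChoosesFrom : ∀ {n} → ListAssignment n → (Fin n → ℕ) → Set
ChoosesFrom L c = ∀ v → (c v ≡ proj₁ (L v)) ⊎ (c v ≡ proj₂ (L v))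

Monochromatic : ∀ {n} → (Fin n → ℕ) → Subset n → Set
Monochromatic c e = ∀ u w → u ∈ₛ e → w ∈ₛ e → c u ≡ c w

TwoListColourable : ∀ {n} → Hypergraph n → Set
TwoListColourable {n} H =
  (L : ListAssignment n) → IsTwoList L →
  Σ (Fin n → ℕ) λ c → ChoosesFrom L c × All (λ e → ¬ Monochromatic c e) H

ProperSub : ∀ {n} → Hypergraph n → Hypergraph n → Set
ProperSub H' H = (∀ e → e ∈ₗ H' → e ∈ₗ H) × ∃[ e ] (e ∈ₗ H × e ∉ₗ H')

MinimallyNonTwoListColourable : ∀ {n} → Hypergraph n → Set
MinimallyNonTwoListColourable {n} H =
  ¬ TwoListColourable H × ((H' : Hypergraph n) → ProperSub H' H → TwoListColourable H')

data Joined {n} (H : Hypergraph n) : Fin n → Fin n → Set where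
  here : ∀ {u} → Joined H u u
  step : ∀ {u w v} e → e ∈ₗ H → u ∈ₛ e → w ∈ₛ e → Joined H w v → Joined H u v

Connected : ∀ {n} → Hypergraph n → Set
Connected H = ∀ u v → IsVertex H u → IsVertex H v → Joined H u v

IsCore : ∀ {n} → Hypergraph n → Set
IsCore H =
  Connected H ×
  (∀ e → e ∈ₗ H → ∀ v → v ∈ₛ e →
     ∃[ e' ] (e' ∈ₗ H × v ∈ₛ e' × (∀ w → w ∈ₛ e → w ∈ₛ e' → w ≡ v)))

-- If H were disconnected, some set T
-- of vertices (those unreachable from a vertex u) would be met by no edge that
-- also leaves T; colouring the edges inside T and those outside T separately,
-- which is possible by minimality, and splicing the two colourings along T would
-- colour H.  If an edge e and a vertex v ∈ e had no edge e' with e ∩ e' = {v},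
-- colour H without e; should e come out monochromatic, switch the colour of v.
-- Every edge through v then contains a second vertex of e, which keeps the old
-- colour of v, so no edge becomes monochromatic and H is colourable again.

module Submission where

open import Defs
open import Data.Nat using (ℕ; suc; _<_; s≤s)
open import Data.Nat.Properties using (<-≤-trans; ≤-refl) renaming (_≟_ to _≟ℕ_)
open import Data.Fin using (Fin)
open import Data.Fin.Properties using (any?; all?) renaming (_≟_ to _≟F_)
open import Data.Fin.Subset using (Subset; ∣_∣; ∁; ⁅_⁆; _-_; _⊆_) renaming (_∈_ to _∈ₛ_; _∉_ to _∉ₛ_)
open import Data.Fin.Subset.Properties using (_∈?_; x∈p⇒∣p-x∣<∣p∣; x∈p∧x≢y⇒x∈p-y; p─q⊆p; x∈∁p⇒x∉p; x∉p⇒x∈∁p; x∉∁p⇒x∈p; x∈⁅y⁆⇒x≡y; x∈⁅x⁆)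
open import Data.Bool using () renaming (_≟_ to _≟B_)
open import Data.Vec.Properties using (≡-dec)
open import Data.Vec.Functional using (updateAt)
open import Data.Vec.Functional.Properties using (updateAt-updates; updateAt-minimal)
open import Data.List using (filter)
open import Data.List.Membership.Propositional using (find; lose) renaming (_∈_ to _∈ₗ_)
open import Data.List.Membership.Propositional.Properties using (∈-filter⁺; ∈-filter⁻)
open import Data.List.Relation.Unary.All using (tabulate; lookup)
open import Data.List.Relation.Unary.Any using (Any) renaming (any? to anyₗ?)
open import Data.Product using (Σ; _×_; ∃; ∃-syntax; proj₁; proj₂; _,_)
open import Data.Sum using (_⊎_; inj₁; inj₂)
open import Function using (_∘_; const)
open import Relation.Nullary using (¬_; Dec; yes; no; contradiction; ¬?)
open import Relation.Nullary.Decidable using (_×-dec_; _→-dec_; decidable-stable; map′)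
open import Relation.Unary using (Decidable)
open import Relation.Binary.PropositionalEquality using (_≡_; _≢_; refl; sym; trans; subst)

private
  variable
    n : ℕ

Colouring : ℕ → Set
Colouring n = Fin n → ℕ

_≟ₛ_ : (e e' : Subset n) → Dec (e ≡ e')
_≟ₛ_ = ≡-dec _≟B_

Monochromatic-cong : ∀ {c d : Colouring n} {e} →
                     (∀ x → x ∈ₛ e → c x ≡ d x) → Monochromatic c e → Monochromatic d e
Monochromatic-cong c≗d mono u w u∈e w∈e = trans (sym (c≗d u u∈e)) (trans (mono u w u∈e w∈e) (c≗d w w∈e))

monochromatic? : (c : Colouring n) (e : Subset n) → Dec (Monochromatic c e)
monochromatic? c e = all? λ u → all? λ w → (u ∈? e) →-dec ((w ∈? e) →-dec (c u ≟ℕ c w))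

filter-proper : ∀ {P : Subset n → Set} (P? : Decidable P) {H : Hypergraph n} {e} →
                e ∈ₗ H → ¬ P e → ProperSub (filter P? H) H
filter-proper P? {H} e∈H ¬Pe =
  (λ _ → proj₁ ∘ ∈-filter⁻ P? {xs = H}) , _ , e∈H , ¬Pe ∘ proj₂ ∘ ∈-filter⁻ P? {xs = H}

splice : Subset n → Colouring n → Colouring n → Colouring n
splice T c₁ c₂ x with x ∈? T
... | yes _ = c₁ x
... | no  _ = c₂ x

splice-∈ : ∀ {T} (c₁ c₂ : Colouring n) {x} → x ∈ₛ T → splice T c₁ c₂ x ≡ c₁ x
splice-∈ {T = T} c₁ c₂ {x} x∈T with x ∈? T
... | yes _   = refl
... | no  x∉T = contradiction x∈T x∉T

splice-∉ : ∀ {T} (c₁ c₂ : Colouring n) {x} → x ∉ₛ T → splice T c₁ c₂ x ≡ c₂ x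
splice-∉ {T = T} c₁ c₂ {x} x∉T with x ∈? T
... | yes x∈T = contradiction x∈T x∉T
... | no  _   = refl

splice-choosesFrom : ∀ {L : ListAssignment n} T {c₁ c₂} →
                     ChoosesFrom L c₁ → ChoosesFrom L c₂ → ChoosesFrom L (splice T c₁ c₂)
splice-choosesFrom T ch₁ ch₂ x with x ∈? T
... | yes _ = ch₁ x
... | no  _ = ch₂ x

otherColour : ∀ {a b k : ℕ} → a ≢ b → k ≡ a ⊎ k ≡ b → ∃[ k' ] ((k' ≡ a ⊎ k' ≡ b) × k' ≢ k)
otherColour a≢b (inj₁ k≡a) = _ , inj₂ refl , λ b≡k → a≢b (trans (sym k≡a) (sym b≡k))
otherColour a≢b (inj₂ k≡b) = _ , inj₁ refl , λ a≡k → a≢b (trans a≡k k≡b)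

switchAt : ∀ {L : ListAssignment n} {c} → IsTwoList L → ChoosesFrom L c → ∀ v →
           ∃[ c' ] (ChoosesFrom L c' × c' v ≢ c v × (∀ x → x ≢ v → c' x ≡ c x))
switchAt {c = c} twoList ch v with otherColour (twoList v) (ch v)
... | k , k∈Lv , k≢cv =
  updateAt c v (const k) , choose , subst (_≢ c v) (sym (updateAt-updates v c)) k≢cv ,
  λ x x≢v → updateAt-minimal x v c x≢v
  where
    choose : ChoosesFrom _ (updateAt c v (const k))
    choose x with x ≟F v
    ... | yes refl rewrite updateAt-updates v {const k} c = k∈Lv
    ... | no  x≢v  rewrite updateAt-minimal x v {const k} c x≢v = ch x

Meets : Subset n → Subset n → Set
Meets T e = ∃[ x ] (x ∈ₛ e × x ∈ₛ T)

meets? : (T e : Subset n) → Dec (Meets T e)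
meets? T e = any? λ x → (x ∈? e) ×-dec (x ∈? T)

Crosses : Subset n → Subset n → Set
Crosses T e = Meets T e × Meets (∁ T) e

SingleIntersection : Subset n → Subset n → Fin n → Set
SingleIntersection e e' v = v ∈ₛ e' × (∀ w → w ∈ₛ e → w ∈ₛ e' → w ≡ v)

singleIntersection? : (e e' : Subset n) (v : Fin n) → Dec (SingleIntersection e e' v)
singleIntersection? e e' v = (v ∈? e') ×-dec all? λ w → (w ∈? e) →-dec ((w ∈? e') →-dec (w ≟F v))

-- The vertices of e other than v keep the colour c v, which v itself has lost.
switched-monochromatic⇒singleIntersection :
  ∀ {c c' : Colouring n} {e e' v} → Monochromatic c e → v ∈ₛ e →
  c' v ≢ c v → (∀ x → x ≢ v → c' x ≡ c x) →
  v ∈ₛ e' → Monochromatic c' e' → SingleIntersection e e' v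
switched-monochromatic⇒singleIntersection {e = e} {e'} {v} mono v∈e c'v≢cv unchanged v∈e' mono' =
  v∈e' , single
  where
    single : ∀ w → w ∈ₛ e → w ∈ₛ e' → w ≡ v
    single w w∈e w∈e' with w ≟F v
    ... | yes w≡v = w≡v
    ... | no  w≢v = contradiction (trans (mono' v w v∈e' w∈e')
                                         (trans (unchanged w w≢v) (mono w v w∈e v∈e))) c'v≢cv

module _ (H : Hypergraph n) where

  Joined-snoc : ∀ {u y x e} → Joined H u y → e ∈ₗ H → y ∈ₛ e → x ∈ₛ e → Joined H u x
  Joined-snoc here                   e∈H y∈e x∈e = step _ e∈H y∈e x∈e here
  Joined-snoc (step f f∈H u∈f w∈f p) e∈H y∈e x∈e = step f f∈H u∈f w∈f (Joined-snoc p e∈H y∈e x∈e)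

  uncrossed-meets⇒⊆ : ∀ {T e} → ¬ Any (Crosses T) H → e ∈ₗ H → Meets T e → e ⊆ T
  uncrossed-meets⇒⊆ {T = T} uncrossed e∈H meet {x} x∈e with x ∈? T
  ... | yes x∈T = x∈T
  ... | no  x∉T = contradiction (lose e∈H (meet , x , x∈e , x∉p⇒x∈∁p x∉T)) uncrossed

  split-colourable : ∀ T → ¬ Any (Crosses T) H →
                     TwoListColourable (filter (meets? T) H) →
                     TwoListColourable (filter (¬? ∘ meets? T) H) →
                     TwoListColourable H
  split-colourable T uncrossed colour₁ colour₂ L twoList
    with colour₁ L twoList | colour₂ L twoList
  ... | c₁ , ch₁ , proper₁ | c₂ , ch₂ , proper₂ =
    splice T c₁ c₂ , splice-choosesFrom T ch₁ ch₂ , tabulate proper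
    where
      proper : ∀ {e} → e ∈ₗ H → ¬ Monochromatic (splice T c₁ c₂) e
      proper {e} e∈H with meets? T e
      ... | yes meet = lookup proper₁ (∈-filter⁺ (meets? T) e∈H meet)
                     ∘ Monochromatic-cong λ x x∈e → splice-∈ c₁ c₂ (uncrossed-meets⇒⊆ uncrossed e∈H meet x∈e)
      ... | no ¬meet = lookup proper₂ (∈-filter⁺ (¬? ∘ meets? T) e∈H ¬meet)
                     ∘ Monochromatic-cong λ x x∈e → splice-∉ c₁ c₂ λ x∈T → ¬meet (x , x∈e , x∈T)

  record Unreachable (u : Fin n) (T : Subset n) : Set where
    field
      source∉   : u ∉ₛ T
      joined    : ∀ z → z ∉ₛ T → Joined H u z
      uncrossed : ¬ Any (Crosses T) H

  shrinkUnreachable : ∀ {u} k T → ∣ T ∣ < k → u ∉ₛ T → (∀ z → z ∉ₛ T → Joined H u z) →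
                      Σ (Subset n) (Unreachable u)
  shrinkUnreachable (suc k) T (s≤s ∣T∣≤k) u∉T joined with anyₗ? (λ e → meets? T e ×-dec meets? (∁ T) e) H
  ... | no uncrossed = T , record { source∉ = u∉T ; joined = joined ; uncrossed = uncrossed }
  ... | yes crossing with find crossing
  ...   | e , e∈H , (x , x∈e , x∈T) , (y , y∈e , y∈∁T) =
    shrinkUnreachable k (T - x) (<-≤-trans (x∈p⇒∣p-x∣<∣p∣ x∈T) ∣T∣≤k) (u∉T ∘ p─q⊆p T ⁅ x ⁆) joined'
    where
      joined' : ∀ z → z ∉ₛ T - x → Joined H _ z
      joined' z z∉T-x with z ∈? T | z ≟F x
      ... | no z∉T  | _        = joined z z∉T
      ... | yes _   | yes refl = Joined-snoc (joined y (x∈∁p⇒x∉p y∈∁T)) e∈H y∈e x∈e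
      ... | yes z∈T | no z≢x   = contradiction (x∈p∧x≢y⇒x∈p-y z∈T z≢x) z∉T-x

  unreachable : ∀ u → Σ (Subset n) (Unreachable u)
  unreachable u = shrinkUnreachable (suc ∣ ∁ ⁅ u ⁆ ∣) (∁ ⁅ u ⁆) (s≤s ≤-refl)
                    (λ u∈∁u → x∈∁p⇒x∉p u∈∁u (x∈⁅x⁆ u))
                    (λ z z∉∁u → subst (Joined H u) (sym (x∈⁅y⁆⇒x≡y u (x∉∁p⇒x∈p z∉∁u))) here)

  minimal⇒connected : MinimallyNonTwoListColourable H → Connected H
  minimal⇒connected (uncolourable , minimal) u v (eᵤ , eᵤ∈H , u∈eᵤ) (eᵥ , eᵥ∈H , v∈eᵥ)
    with unreachable u
  ... | T , unr with v ∈? T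
  ...   | no v∉T = Unreachable.joined unr v v∉T
  ...   | yes v∈T =
    contradiction (split-colourable T uncrossed (minimal _ eᵤ-dropped) (minimal _ eᵥ-dropped)) uncolourable
    where
      open Unreachable unr
      eᵤ-dropped : ProperSub (filter (meets? T) H) H
      eᵤ-dropped = filter-proper (meets? T) eᵤ∈H λ meet → source∉ (uncrossed-meets⇒⊆ uncrossed eᵤ∈H meet u∈eᵤ)
      eᵥ-dropped : ProperSub (filter (¬? ∘ meets? T) H) H
      eᵥ-dropped = filter-proper (¬? ∘ meets? T) eᵥ∈H λ ¬meet → ¬meet (v , v∈eᵥ , v∈T)

  colourable-without-singleIntersection :
    ∀ {e v} → e ∈ₗ H → v ∈ₛ e → ¬ (∃[ e' ] (e' ∈ₗ H × SingleIntersection e e' v)) →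
    TwoListColourable (filter (¬? ∘ (_≟ₛ e)) H) → TwoListColourable H
  colourable-without-singleIntersection {e} {v} e∈H v∈e noSingle colour L twoList
    with colour L twoList
  ... | c , ch , proper with monochromatic? c e
  ...   | no ¬mono = c , ch , tabulate properₑ
    where
      properₑ : ∀ {e'} → e' ∈ₗ H → ¬ Monochromatic c e'
      properₑ {e'} e'∈H with e' ≟ₛ e
      ... | yes refl = ¬mono
      ... | no e'≢e  = lookup proper (∈-filter⁺ (¬? ∘ (_≟ₛ e)) e'∈H e'≢e)
  ...   | yes mono with switchAt twoList ch v
  ...     | c' , ch' , c'v≢cv , unchanged = c' , ch' , tabulate proper'
    where
      proper' : ∀ {e'} → e' ∈ₗ H → ¬ Monochromatic c' e'
      proper' {e'} e'∈H mono' with v ∈? e'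
      ... | yes v∈e' = noSingle (e' , e'∈H ,
              switched-monochromatic⇒singleIntersection mono v∈e c'v≢cv unchanged v∈e' mono')
      ... | no  v∉e' = lookup proper (∈-filter⁺ (¬? ∘ (_≟ₛ e)) e'∈H λ { refl → v∉e' v∈e })
                         (Monochromatic-cong (λ x x∈e' → unchanged x λ { refl → v∉e' x∈e' }) mono')

  minimal⇒singleIntersection : MinimallyNonTwoListColourable H →
                               ∀ e → e ∈ₗ H → ∀ v → v ∈ₛ e → ∃[ e' ] (e' ∈ₗ H × SingleIntersection e e' v)
  minimal⇒singleIntersection (uncolourable , minimal) e e∈H v v∈e =
    decidable-stable (map′ find (λ (_ , e'∈H , single) → lose e'∈H single)
                           (anyₗ? (λ e' → singleIntersection? e e' v) H))
      λ noSingle → uncolourable (colourable-without-singleIntersection e∈H v∈e noSingle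
                     (minimal _ (filter-proper (¬? ∘ (_≟ₛ e)) e∈H λ e≢e → e≢e refl)))

mainTheorem14 : ∀ (n : ℕ) (H : Hypergraph n) → MinimallyNonTwoListColourable H → IsCore H
mainTheorem14 n H minimal = minimal⇒connected H minimal , minimal⇒singleIntersection H minimal
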